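{- Let $T$ be a tree and let $\ell$ be an integer with $1\le \ell\le |V(T)|/2$. Then either $T$ contains at least $|V(T)|-2\ell+2$ leaves, or for every vertex $v$ of $T$ there is a subtree of $T$ with exactly $2\ell$ vertices which contains $v$ and has a perfect matching. -}

module Defs where

open import Data.Nat using (ℕ; zero; suc; _+_; _≤_; _<_)
open import Data.Fin using (Fin; zero; suc; inject₁; fromℕ)
open import Data.Bool using (Bool; true; false; if_then_else_)
open import Data.Product using (Σ; ∃; _×_; _,_)
open import Data.Unit using (⊤)
open import Relation.Nullary using (¬_)
open import Relation.Binary.PropositionalEquality using (_≡_)
open import Function.Definitions using (Injective)

record Graph (n : ℕ) : Set where
  field
    adj   : Fin n → Fin n → Bool
    sym   : ∀ u v → adj u v ≡ adj v u
    irrefl : ∀ v → adj v v ≡ false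
open Graph public

count : ∀ {n} → (Fin n → Bool) → ℕ
count {zero}  f = 0
count {suc n} f = (if f zero then 1 else 0) + count (λ i → f (suc i))

degree : ∀ {n} → Graph n → Fin n → ℕ
degree G v = count (adj G v)

isLeaf : ∀ {n} → Graph n → Fin n → Bool
isLeaf G v with degree G v
... | 1 = true
... | _ = false

leaves : ∀ {n} → Graph n → ℕ
leaves G = count (isLeaf G)

data Walk {n} (G : Graph n) (S : Fin n → Bool) : Fin n → Fin n → Set where
  here : ∀ {u} → S u ≡ true → Walk G S u u
  step : ∀ {u w v} → S u ≡ true → adj G u w ≡ true → Walk G S w v → Walk G S u v

Connected : ∀ {n} → Graph n → Set
Connected G = ∀ u v → Walk G (λ _ → true) u v

record Cycle {n} (G : Graph n) : Set where
  field
    k    : ℕ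
    c    : Fin (3 + k) → Fin n
    inj  : Injective _≡_ _≡_ c
    cons : ∀ (i : Fin (2 + k)) → adj G (c (inject₁ i)) (c (suc i)) ≡ true
    close : adj G (c (fromℕ (2 + k))) (c zero) ≡ true

Acyclic : ∀ {n} → Graph n → Set
Acyclic G = ¬ Cycle G

IsTree : ∀ {n} → Graph n → Set
IsTree {n} G = 1 ≤ n × Connected G × Acyclic G

-- The vertex set S induces a connected subgraph of G (i.e. S spans a
-- subtree when G is a tree): S is nonempty and any two vertices of S are
-- joined by a walk inside S.
InducesSubtree : ∀ {n} → Graph n → (Fin n → Bool) → Set
InducesSubtree G S =
  (∃ λ v → S v ≡ true) ×
  (∀ u v → S u ≡ true → S v ≡ true → Walk G S u v)

record PerfectMatching {n} (G : Graph n) (S : Fin n → Bool) : Set where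
  field
    partner : Fin n → Fin n
    inS     : ∀ v → S v ≡ true → S (partner v) ≡ true
    edge    : ∀ v → S v ≡ true → adj G v (partner v) ≡ true
    invol   : ∀ v → S v ≡ true → partner (partner v) ≡ v

-- Grow a subtree with a perfect matching greedily, starting from an edge at v:
-- whenever some vertex u outside S is adjacent to S and has a further
-- neighbour w outside S, add the edge uw to both S and its matching. If this
-- is impossible before S reaches 2ℓ vertices, every vertex outside S is a
-- leaf: it has a neighbour in S (follow a path into S), only one there
-- (otherwise T has a cycle), and none outside S (that would be an edge to
-- add). Hence T has at least n − (2ℓ − 2) leaves.
module Submission where

open import Defs
open import Data.Nat using (ℕ; _+_; _*_; _∸_; _≤_)
open import Data.Fin using (Fin)
open import Data.Bool using (Bool; true)
open import Data.Product using (Σ; _×_)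
open import Data.Sum using (_⊎_)
open import Relation.Binary.PropositionalEquality using (_≡_)

open import Data.Nat using (zero; suc; z≤n; s≤s; _≤?_)
import Data.Nat.Properties as ℕ
open import Data.Fin using (zero; suc; inject₁; fromℕ)
open import Data.Fin.Properties using (_≟_; any?; suc-injective)
open import Data.Bool using (false; not)
import Data.Bool.Properties as Bool
open import Data.Product using (∃-syntax; _,_; proj₁)
open import Data.Sum using (inj₁; inj₂)
open import Data.Empty using (⊥-elim)
open import Relation.Nullary using (¬_; Dec; yes; no)
open import Relation.Nullary.Decidable using (_×-dec_)
open import Relation.Binary.PropositionalEquality as ≡
  using (_≢_; _≗_; refl; trans; cong; subst; module ≡-Reasoning)
open import Function.Definitions using (Injective)

private
  variable
    n k : ℕ

infix 4 _⊆_

_⊆_ : (Fin n → Bool) → (Fin n → Bool) → Set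
S ⊆ S′ = ∀ i → S i ≡ true → S′ i ≡ true

∈-∉⇒≢ : ∀ {S : Fin n → Bool} {y u} → S y ≡ true → S u ≡ false → y ≢ u
∈-∉⇒≢ y∈ u∉ refl = Bool.not-¬ y∈ u∉

count-cong : {f g : Fin n → Bool} → f ≗ g → count f ≡ count g
count-cong {zero}  f≗g = refl
count-cong {suc n} f≗g rewrite f≗g zero = cong (_ +_) (count-cong (λ i → f≗g (suc i)))

count-none : {f : Fin n → Bool} → (∀ i → f i ≡ false) → count f ≡ 0
count-none {zero}  none = refl
count-none {suc n} none rewrite none zero = count-none (λ i → none (suc i))

count-single : {f : Fin n → Bool} (s : Fin n) → f s ≡ true → (∀ i → f i ≡ true → i ≡ s) →
               count f ≡ 1
count-single {suc n} {f} zero fs only rewrite fs = cong suc (count-none rest)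
  where
  rest : ∀ i → f (suc i) ≡ false
  rest i with f (suc i) in eq
  ... | false = refl
  ... | true with () ← only (suc i) eq
count-single {suc n} {f} (suc s) fs only with f zero in eq
... | true with () ← only zero eq
... | false = count-single s fs (λ i e → suc-injective (only (suc i) e))

count-raise : {f g : Fin n → Bool} (u : Fin n) → g u ≡ true → f u ≡ false →
              (∀ i → i ≢ u → g i ≡ f i) → count g ≡ suc (count f)
count-raise {suc n} zero gu fu agree rewrite gu | fu =
  cong suc (count-cong (λ i → agree (suc i) (λ ())))
count-raise {suc n} (suc u) gu fu agree rewrite agree zero (λ ()) =
  trans (cong (_ +_) (count-raise u gu fu (λ i i≢u → agree (suc i) (λ e → i≢u (suc-injective e)))))
        (ℕ.+-suc _ _)

count-mono : {f g : Fin n → Bool} → f ⊆ g → count f ≤ count g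
count-mono {zero}          f⊆g = z≤n
count-mono {suc n} {f} {g} f⊆g with f zero in ef | g zero in eg
... | true  | true  = s≤s (count-mono (λ i → f⊆g (suc i)))
... | true  | false = ⊥-elim (Bool.not-¬ (f⊆g zero ef) eg)
... | false | true  = ℕ.m≤n⇒m≤1+n (count-mono (λ i → f⊆g (suc i)))
... | false | false = count-mono (λ i → f⊆g (suc i))

count-not+count : (f : Fin n → Bool) → count (λ i → not (f i)) + count f ≡ n
count-not+count {zero}  f = refl
count-not+count {suc n} f with f zero
... | true  = trans (ℕ.+-suc _ _) (cong suc (count-not+count (λ i → f (suc i))))
... | false = cong suc (count-not+count (λ i → f (suc i)))

count-not : (f : Fin n → Bool) → count (λ i → not (f i)) ≡ n ∸ count f
count-not {n} f = begin
  count (λ i → not (f i))               ≡⟨ ℕ.m+n∸n≡m _ (count f) ⟨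
  count (λ i → not (f i)) + count f ∸ count f ≡⟨ cong (_∸ count f) (count-not+count f) ⟩
  n ∸ count f                           ∎
  where open ≡-Reasoning

insert : Fin n → (Fin n → Bool) → Fin n → Bool
insert u S i with i ≟ u
... | yes _ = true
... | no  _ = S i

insert-self : (u : Fin n) (S : Fin n → Bool) → insert u S u ≡ true
insert-self u S with u ≟ u
... | yes _   = refl
... | no  u≢u = ⊥-elim (u≢u refl)

insert-other : (u : Fin n) (S : Fin n → Bool) {i : Fin n} → i ≢ u → insert u S i ≡ S i
insert-other u S {i} i≢u with i ≟ u
... | yes i≡u = ⊥-elim (i≢u i≡u)
... | no  _   = refl

⊆-insert : (u : Fin n) (S : Fin n → Bool) → S ⊆ insert u S
⊆-insert u S i i∈ with i ≟ u
... | yes _ = refl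
... | no  _ = i∈

insert-cases : (u : Fin n) (S : Fin n → Bool) {i : Fin n} → insert u S i ≡ true → i ≡ u ⊎ S i ≡ true
insert-cases u S {i} i∈ with i ≟ u
... | yes i≡u = inj₁ i≡u
... | no  _   = inj₂ i∈

count-insert : (u : Fin n) (S : Fin n → Bool) → S u ≡ false → count (insert u S) ≡ suc (count S)
count-insert u S u∉ = count-raise u (insert-self u S) u∉ (λ i → insert-other u S)

ConnectedOn : Graph n → (Fin n → Bool) → Set
ConnectedOn G S = ∀ a b → S a ≡ true → S b ≡ true → Walk G S a b

PendantEdge : Graph n → (Fin n → Bool) → Set
PendantEdge G S = ∃[ u ] ∃[ w ] ∃[ s ]
  (S u ≡ false × S w ≡ false × adj G u w ≡ true × S s ≡ true × adj G u s ≡ true)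

pendantEdge? : (G : Graph n) (S : Fin n → Bool) → Dec (PendantEdge G S)
pendantEdge? G S = any? λ u → any? λ w → any? λ s →
  (S u Bool.≟ false) ×-dec (S w Bool.≟ false) ×-dec (adj G u w Bool.≟ true) ×-dec
  (S s Bool.≟ true) ×-dec (adj G u s Bool.≟ true)

module _ {G : Graph n} where

  adj-sym : ∀ {u v} → adj G u v ≡ true → adj G v u ≡ true
  adj-sym {u} {v} u~v = trans (Graph.sym G v u) u~v

  walk-source : ∀ {S a b} → Walk G S a b → S a ≡ true
  walk-source (here a∈)     = a∈
  walk-source (step a∈ _ _) = a∈

  infixr 5 _++ʷ_

  _++ʷ_ : ∀ {S a b c} → Walk G S a b → Walk G S b c → Walk G S a c
  here _        ++ʷ W′ = W′
  step a∈ e W   ++ʷ W′ = step a∈ e (W ++ʷ W′)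

  reverseʷ : ∀ {S a b} → Walk G S a b → Walk G S b a
  reverseʷ (here a∈)     = here a∈
  reverseʷ (step a∈ e W) = reverseʷ W ++ʷ step (walk-source W) (adj-sym e) (here a∈)

  walk-⊆ : ∀ {S S′ a b} → S ⊆ S′ → Walk G S a b → Walk G S′ a b
  walk-⊆ S⊆S′ (here a∈)     = here (S⊆S′ _ a∈)
  walk-⊆ S⊆S′ (step a∈ e W) = step (S⊆S′ _ a∈) e (walk-⊆ S⊆S′ W)

  walk-first-edge : ∀ {S a b} → Walk G S a b → a ≢ b → ∃[ w ] adj G a w ≡ true
  walk-first-edge (here _)     a≢a = ⊥-elim (a≢a refl)
  walk-first-edge (step _ e _) _   = _ , e

  connected-via : ∀ {S} h → (∀ y → S y ≡ true → Walk G S y h) → ConnectedOn G S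
  connected-via h to-h a b a∈ b∈ = to-h a a∈ ++ʷ reverseʷ (to-h b b∈)

  record Path (S : Fin n → Bool) (k : ℕ) (a b : Fin n) : Set where
    field
      vertex    : Fin (suc k) → Fin n
      injective : Injective _≡_ _≡_ vertex
      edge      : ∀ (i : Fin k) → adj G (vertex (inject₁ i)) (vertex (suc i)) ≡ true
      first     : vertex zero ≡ a
      last      : vertex (fromℕ k) ≡ b
      inside    : ∀ i → S (vertex i) ≡ true

  module _ {S : Fin n → Bool} where

    trivial-path : ∀ {a} → S a ≡ true → Path S 0 a a
    trivial-path {a} a∈ = record
      { vertex = λ _ → a ; injective = λ { {zero} {zero} _ → refl } ; edge = λ ()
      ; first = refl ; last = refl ; inside = λ _ → a∈ }

    path-tail : ∀ {a b} (P : Path S (suc k) a b) → Path S k (Path.vertex P (suc zero)) b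
    path-tail P = record
      { vertex = λ i → vertex (suc i) ; injective = λ e → suc-injective (injective e)
      ; edge = λ i → edge (suc i) ; first = refl ; last = last ; inside = λ i → inside (suc i) }
      where open Path P

    path-from : ∀ {a b u} (P : Path S k a b) (j : Fin (suc k)) → Path.vertex P j ≡ u → ∃[ k′ ] Path S k′ u b
    path-from         P zero    eq = _ , record { Path P hiding (first) ; first = eq }
    path-from {suc k} P (suc j) eq = path-from (path-tail P) j eq

    path-cons : ∀ {u w b} → S u ≡ true → adj G u w ≡ true → (P : Path S k w b) →
                (∀ j → Path.vertex P j ≢ u) → Path S (suc k) u b
    path-cons {k} {u} {w} u∈ u~w P u∉P = record
      { vertex = vertex′ ; injective = injective′ ; edge = edge′
      ; first = refl ; last = last ; inside = inside′ }
      where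
      open Path P
      vertex′ : Fin (suc (suc k)) → Fin n
      vertex′ zero    = u
      vertex′ (suc i) = vertex i
      injective′ : Injective _≡_ _≡_ vertex′
      injective′ {zero}  {zero}  _ = refl
      injective′ {zero}  {suc j} e = ⊥-elim (u∉P j (≡.sym e))
      injective′ {suc i} {zero}  e = ⊥-elim (u∉P i e)
      injective′ {suc i} {suc j} e = cong suc (injective e)
      edge′ : ∀ (i : Fin (suc k)) → adj G (vertex′ (inject₁ i)) (vertex′ (suc i)) ≡ true
      edge′ zero    = subst (λ z → adj G u z ≡ true) (≡.sym first) u~w
      edge′ (suc i) = edge i
      inside′ : ∀ i → S (vertex′ i) ≡ true
      inside′ zero    = u∈
      inside′ (suc i) = inside i

    -- Shortcut the walk at the first repeated vertex, working from the end.
    walk⇒path : ∀ {a b} → Walk G S a b → ∃[ k ] Path S k a b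
    walk⇒path (here a∈) = 0 , trivial-path a∈
    walk⇒path {a = u} (step u∈ u~w W) with walk⇒path W
    ... | k , P with any? (λ j → Path.vertex P j ≟ u)
    ... | yes (j , eq) = path-from P j eq
    ... | no  u∉P      = suc k , path-cons u∈ u~w P (λ j eq → u∉P (j , eq))

    apex+path⇒cycle : ∀ {x s s′} → S x ≡ false → adj G x s ≡ true → adj G x s′ ≡ true →
                      Path S (suc k) s s′ → Cycle G
    apex+path⇒cycle {k} {x} {s} {s′} x∉ x~s x~s′ P = record
      { k = k ; c = c ; inj = c-injective ; cons = c-edge ; close = c-close }
      where
      open Path P
      c : Fin (3 + k) → Fin n
      c zero    = x
      c (suc i) = vertex i
      x≢vertex : ∀ i → x ≢ vertex i
      x≢vertex i x≡ = ∈-∉⇒≢ (inside i) x∉ (≡.sym x≡)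
      c-injective : Injective _≡_ _≡_ c
      c-injective {zero}  {zero}  _ = refl
      c-injective {zero}  {suc j} e = ⊥-elim (x≢vertex j e)
      c-injective {suc i} {zero}  e = ⊥-elim (x≢vertex i (≡.sym e))
      c-injective {suc i} {suc j} e = cong suc (injective e)
      c-edge : ∀ (i : Fin (2 + k)) → adj G (c (inject₁ i)) (c (suc i)) ≡ true
      c-edge zero    = subst (λ z → adj G x z ≡ true) (≡.sym first) x~s
      c-edge (suc i) = edge i
      c-close : adj G (c (fromℕ (2 + k))) x ≡ true
      c-close = subst (λ z → adj G z x ≡ true) (≡.sym last) (adj-sym x~s′)

    acyclic⇒unique-neighbour : Acyclic G → ∀ {x s s′} → S x ≡ false →
                               adj G x s ≡ true → adj G x s′ ≡ true → Walk G S s s′ → s ≡ s′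
    acyclic⇒unique-neighbour acyclic x∉ x~s x~s′ W with walk⇒path W
    ... | zero  , P = trans (≡.sym (Path.first P)) (Path.last P)
    ... | suc k , P = ⊥-elim (acyclic (apex+path⇒cycle x∉ x~s x~s′ P))

  pair-with : Fin n → Fin n → (Fin n → Fin n) → Fin n → Fin n
  pair-with u w partner y with y ≟ u
  ... | yes _ = w
  ... | no  _ with y ≟ w
  ...   | yes _ = u
  ...   | no  _ = partner y

  pair-with-left : ∀ u w p → pair-with u w p u ≡ w
  pair-with-left u w p with u ≟ u
  ... | yes _   = refl
  ... | no  u≢u = ⊥-elim (u≢u refl)

  pair-with-right : ∀ u w p → w ≢ u → pair-with u w p w ≡ u
  pair-with-right u w p w≢u with w ≟ u
  ... | yes w≡u = ⊥-elim (w≢u w≡u)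
  ... | no  _ with w ≟ w
  ...   | yes _   = refl
  ...   | no  w≢w = ⊥-elim (w≢w refl)

  pair-with-other : ∀ u w p {y} → y ≢ u → y ≢ w → pair-with u w p y ≡ p y
  pair-with-other u w p {y} y≢u y≢w with y ≟ u
  ... | yes y≡u = ⊥-elim (y≢u y≡u)
  ... | no  _ with y ≟ w
  ...   | yes y≡w = ⊥-elim (y≢w y≡w)
  ...   | no  _   = refl

  empty-matching : PerfectMatching G (λ _ → false)
  empty-matching = record { partner = λ y → y ; inS = λ _ () ; edge = λ _ () ; invol = λ _ () }

  module AddEdge {S : Fin n → Bool} {u w : Fin n}
                 (u∉ : S u ≡ false) (w∉ : S w ≡ false) (u~w : adj G u w ≡ true) where

    S⁺ : Fin n → Bool
    S⁺ = insert w (insert u S)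

    w≢u : w ≢ u
    w≢u refl = Bool.not-¬ u~w (Graph.irrefl G u)

    u∈S⁺ : S⁺ u ≡ true
    u∈S⁺ = ⊆-insert w _ u (insert-self u S)

    w∈S⁺ : S⁺ w ≡ true
    w∈S⁺ = insert-self w _

    S⊆S⁺ : S ⊆ S⁺
    S⊆S⁺ i i∈ = ⊆-insert w _ i (⊆-insert u S i i∈)

    S⁺-cases : ∀ y → S⁺ y ≡ true → y ≡ w ⊎ y ≡ u ⊎ S y ≡ true
    S⁺-cases y y∈ with insert-cases w _ y∈
    ... | inj₁ y≡w = inj₁ y≡w
    ... | inj₂ y∈′ = inj₂ (insert-cases u S y∈′)

    count-S⁺ : count S⁺ ≡ 2 + count S
    count-S⁺ = trans (count-insert w (insert u S) (trans (insert-other u S w≢u) w∉))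
                     (cong suc (count-insert u S u∉))

    matching⁺ : PerfectMatching G S → PerfectMatching G S⁺
    matching⁺ M = record { partner = p⁺ ; inS = inS⁺ ; edge = edge⁺ ; invol = invol⁺ }
      where
      open PerfectMatching M
      p⁺ : Fin n → Fin n
      p⁺ = pair-with u w partner
      p⁺-u : p⁺ u ≡ w
      p⁺-u = pair-with-left u w partner
      p⁺-w : p⁺ w ≡ u
      p⁺-w = pair-with-right u w partner w≢u
      p⁺-old : ∀ {y} → S y ≡ true → p⁺ y ≡ partner y
      p⁺-old y∈ = pair-with-other u w partner (∈-∉⇒≢ y∈ u∉) (∈-∉⇒≢ y∈ w∉)
      inS⁺ : ∀ y → S⁺ y ≡ true → S⁺ (p⁺ y) ≡ true
      inS⁺ y y∈ with S⁺-cases y y∈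
      ... | inj₁ refl        rewrite p⁺-w        = u∈S⁺
      ... | inj₂ (inj₁ refl) rewrite p⁺-u        = w∈S⁺
      ... | inj₂ (inj₂ y∈S)  rewrite p⁺-old y∈S = S⊆S⁺ _ (inS y y∈S)
      edge⁺ : ∀ y → S⁺ y ≡ true → adj G y (p⁺ y) ≡ true
      edge⁺ y y∈ with S⁺-cases y y∈
      ... | inj₁ refl        rewrite p⁺-w        = adj-sym u~w
      ... | inj₂ (inj₁ refl) rewrite p⁺-u        = u~w
      ... | inj₂ (inj₂ y∈S)  rewrite p⁺-old y∈S = edge y y∈S
      invol⁺ : ∀ y → S⁺ y ≡ true → p⁺ (p⁺ y) ≡ y
      invol⁺ y y∈ with S⁺-cases y y∈
      ... | inj₁ refl        rewrite p⁺-w = p⁺-u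
      ... | inj₂ (inj₁ refl) rewrite p⁺-u = p⁺-w
      ... | inj₂ (inj₂ y∈S)  rewrite p⁺-old y∈S | p⁺-old (inS y y∈S) = invol y y∈S

    connected⁺ : ∀ {s} → S s ≡ true → adj G u s ≡ true → ConnectedOn G S → ConnectedOn G S⁺
    connected⁺ {s} s∈ u~s connected = connected-via s to-s
      where
      to-s : ∀ y → S⁺ y ≡ true → Walk G S⁺ y s
      to-s y y∈ with S⁺-cases y y∈
      ... | inj₁ refl        = step w∈S⁺ (adj-sym u~w) (step u∈S⁺ u~s (here (S⊆S⁺ s s∈)))
      ... | inj₂ (inj₁ refl) = step u∈S⁺ u~s (here (S⊆S⁺ s s∈))
      ... | inj₂ (inj₂ y∈S)  = walk-⊆ S⊆S⁺ (connected y s y∈S s∈)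

  -- Along a walk into S, the vertex just before S is adjacent to S; without
  -- pendant edges this propagates back to the start.
  no-pendant⇒neighbour-in : ∀ {S : Fin n → Bool} {a b} → ¬ PendantEdge G S →
                            Walk G (λ _ → true) a b → S a ≡ false → S b ≡ true →
                            ∃[ s ] S s ≡ true × adj G a s ≡ true
  no-pendant⇒neighbour-in none (here _) a∉ a∈ = ⊥-elim (Bool.not-¬ a∈ a∉)
  no-pendant⇒neighbour-in {S} {a} none (step {w = y} _ a~y W) a∉ b∈ with S y in y∈?
  ... | true  = y , y∈? , a~y
  ... | false with no-pendant⇒neighbour-in none W y∈? b∈
  ...   | s , s∈ , y~s = ⊥-elim (none (y , a , s , y∈? , a∉ , adj-sym a~y , s∈ , y~s))

  degree≡1⇒isLeaf : ∀ x → degree G x ≡ 1 → isLeaf G x ≡ true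
  degree≡1⇒isLeaf x deg≡1 with degree G x | deg≡1
  ... | .1 | refl = refl

  module _ (connected : Connected G) (acyclic : Acyclic G)
           {S : Fin n → Bool} {v : Fin n} (v∈ : S v ≡ true) (S-connected : ConnectedOn G S)
           (none : ¬ PendantEdge G S) where

    no-pendant⇒leaf : ∀ x → S x ≡ false → isLeaf G x ≡ true
    no-pendant⇒leaf x x∉ with no-pendant⇒neighbour-in none (connected x v) x∉ v∈
    ... | s , s∈ , x~s = degree≡1⇒isLeaf x (count-single s x~s only-s)
      where
      only-s : ∀ y → adj G x y ≡ true → y ≡ s
      only-s y x~y with S y in y∈?
      ... | false = ⊥-elim (none (x , y , s , x∉ , y∈? , x~y , s∈ , x~s))
      ... | true  = acyclic⇒unique-neighbour acyclic x∉ x~y x~s (S-connected y s y∈? s∈)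

    no-pendant⇒leaves≥ : n ∸ count S ≤ leaves G
    no-pendant⇒leaves≥ = subst (_≤ leaves G) (count-not S)
      (count-mono (λ x x∉ → no-pendant⇒leaf x (Bool.not-injective x∉)))

another-vertex : 2 ≤ n → (v : Fin n) → ∃[ t ] t ≢ v
another-vertex {suc zero}    (s≤s ()) _
another-vertex {suc (suc _)} _ zero    = suc zero , λ ()
another-vertex {suc (suc _)} _ (suc _) = zero , λ ()

MatchedSubtree : Graph n → Fin n → ℕ → Set
MatchedSubtree {n} G v m = Σ (Fin n → Bool) λ S →
  InducesSubtree G S × count S ≡ m × S v ≡ true × PerfectMatching G S

module _ {G : Graph n} {v : Fin n} where

  matched-edge : Connected G → 2 ≤ n → MatchedSubtree G v 2
  matched-edge connected 2≤n with another-vertex 2≤n v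
  ... | t , t≢v with walk-first-edge (connected v t) (λ v≡t → t≢v (≡.sym v≡t))
  ... | w , v~w = S⁺ , ((w , w∈S⁺) , connected-via v to-v) , size , u∈S⁺ , matching⁺ empty-matching
    where
    open AddEdge {G = G} {S = λ _ → false} refl refl v~w
    size : count S⁺ ≡ 2
    size = trans count-S⁺ (cong (2 +_) (count-none {n} (λ _ → refl)))
    to-v : ∀ y → S⁺ y ≡ true → Walk G S⁺ y v
    to-v y y∈ with S⁺-cases y y∈
    ... | inj₁ refl        = step w∈S⁺ (adj-sym {G = G} v~w) (here u∈S⁺)
    ... | inj₂ (inj₁ refl) = here u∈S⁺
    ... | inj₂ (inj₂ ())

  extend-by-pendant : ∀ {m} (M : MatchedSubtree G v m) → PendantEdge G (proj₁ M) → MatchedSubtree G v (2 + m)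
  extend-by-pendant (S , (_ , S-connected) , size , v∈ , matching) (u , w , s , u∉ , w∉ , u~w , s∈ , u~s) =
    S⁺ , ((w , w∈S⁺) , connected⁺ s∈ u~s S-connected) , trans count-S⁺ (cong (2 +_) size) ,
    S⊆S⁺ v v∈ , matching⁺ matching
    where open AddEdge {G = G} {S = S} u∉ w∉ u~w

m∸[o+n]+o≡m∸n : ∀ m n o → o + n ≤ m → m ∸ (o + n) + o ≡ m ∸ n
m∸[o+n]+o≡m∸n m n o o+n≤m = begin
  m ∸ (o + n) + o ≡⟨ cong (λ z → m ∸ z + o) (ℕ.+-comm o n) ⟩
  m ∸ (n + o) + o ≡⟨ cong (_+ o) (ℕ.∸-+-assoc m n o) ⟨
  m ∸ n ∸ o + o   ≡⟨ ℕ.m∸n+n≡m (ℕ.m+n≤o⇒m≤o∸n o o+n≤m) ⟩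
  m ∸ n           ∎
  where open ≡-Reasoning

grow-matched-subtree : ∀ {T : Graph n} → IsTree T → ∀ v j → 2 * suc j ≤ n →
       MatchedSubtree T v (2 * suc j) ⊎ n ∸ 2 * j ≤ leaves T
grow-matched-subtree (_ , connected , _) v zero 2≤n = inj₁ (matched-edge connected 2≤n)
grow-matched-subtree {n} {T} tree@(_ , connected , acyclic) v (suc j) room
  with grow-matched-subtree tree v j (ℕ.≤-trans (ℕ.*-monoʳ-≤ 2 (ℕ.n≤1+n (suc j))) room)
... | inj₂ many = inj₂ (ℕ.≤-trans (ℕ.∸-monoʳ-≤ n (ℕ.*-monoʳ-≤ 2 (ℕ.n≤1+n j))) many)
... | inj₁ M@(S , (_ , S-connected) , size , v∈ , _) with pendantEdge? T S
...   | yes pendant = inj₁ (subst (MatchedSubtree T v) (≡.sym (ℕ.*-suc 2 (suc j)))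
                                (extend-by-pendant M pendant))
...   | no  none    = inj₂ (subst (λ m → n ∸ m ≤ leaves T) size
                              (no-pendant⇒leaves≥ connected acyclic v∈ S-connected none))

lemma5 : ∀ {n} (T : Graph n) → IsTree T → (ℓ : ℕ) → 1 ≤ ℓ → 2 * ℓ ≤ n →
         (n ∸ 2 * ℓ + 2 ≤ leaves T)
         ⊎ (∀ (v : Fin n) → Σ (Fin n → Bool) λ S →
              InducesSubtree T S × count S ≡ 2 * ℓ × S v ≡ true × PerfectMatching T S)
lemma5 {n} T tree (suc j) _ 2ℓ≤n with n ∸ 2 * suc j + 2 ≤? leaves T
... | yes many = inj₁ many
... | no  few  = inj₂ matched
  where
  matched : ∀ v → MatchedSubtree T v (2 * suc j)
  matched v with grow-matched-subtree tree v j 2ℓ≤n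
  ... | inj₁ M    = M
  ... | inj₂ many = ⊥-elim (few (subst (_≤ leaves T) n∸2j≡n∸2ℓ+2 many))
    where
    n∸2j≡n∸2ℓ+2 : n ∸ 2 * j ≡ n ∸ 2 * suc j + 2
    n∸2j≡n∸2ℓ+2 = ≡.sym (trans (cong (λ m → n ∸ m + 2) (ℕ.*-suc 2 j))
                         (m∸[o+n]+o≡m∸n n (2 * j) 2 (subst (_≤ n) (ℕ.*-suc 2 j) 2ℓ≤n)))
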